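{- Let $m,n\geq-1$ be integers, $L\in\mathrm{Hom}(n,m)$ and $R\in\mathrm{Hom}(m,n)$ reshuffles. Then $L\dashv R$ if and only if for all $i\in\{=,0,\ldots,n,\top\}$ and $j\in\{=,0,\ldots,m,\top\}$ we have $i\leq j\cdot L\iff i\cdot R\leq j$. Consequently: a reshuffle $R$ has a left adjoint if and only if $(=\cdot R)=(=)$, and then $j\cdot L$ is the greatest $i\in\{=,0,\ldots,n,\top\}$ with $i\cdot R\leq j$ (also for $j=\top$); and a reshuffle $L$ has a right adjoint if and only if $j\cdot L<\top$ for all $j<\top$, and then $i\cdot R$ is the least $j\in\{=,0,\ldots,m,\top\}$ with $i\leq j\cdot L$ (also for $i=\top$).
   Context: Index sets are totally ordered as $=\,<0<1<\cdots<\top$. For integers $m,n\geq-1$, a reshuffle $F\in\mathrm{Hom}(m,n)$ is an increasing function $F:\{=,0,\ldots,n\}\to\{=,0,\ldots,m,\top\}$, $k\mapsto k\cdot F$; it is extended by $\top\cdot F=\top$. Reshuffles are ordered pointwise ($F\leq G$ iff $k\cdot F\leq k\cdot G$ for all $k$). The identity is $k\cdot\mathrm{id}_n=k$, and for $F\in\mathrm{Hom}(m,n)$, $G\in\mathrm{Hom}(n,p)$ the composite $G\circ F\in\mathrm{Hom}(m,p)$ is $k\cdot(G\circ F)=(k\cdot G)\cdot F$. In this 2-poset, $L\in\mathrm{Hom}(x,y)$ is left adjoint to $R\in\mathrm{Hom}(y,x)$, written $L\dashv R$, if $\mathrm{id}_x\leq R\circ L$ and $L\circ R\leq\mathrm{id}_y$.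 -}

module Defs where

open import Data.Nat using (ℕ; zero; suc)
open import Data.Fin using (Fin; zero; suc; inject₁; fromℕ; _≤_; _<_)
open import Data.Product using (_×_)

-- Encoding: the paper's object m ≥ -1 is represented by the natural number
-- m + 1.  Hence, for the code object m : ℕ,
--   the index set {=,0,...,m-1,⊤} (paper: {=,0,...,m,⊤}) is  Fin (suc (suc m)),
--   with  zero  playing "=",  suc k  playing the paper's index k (for k < m),
--   and  fromℕ (suc m)  (the last element) playing ⊤;
--   the domain {=,0,...} without ⊤ is  Fin (suc m)  (embedded via inject₁).

Idx : ℕ → Set
Idx m = Fin (suc (suc m))

Idx⁻ : ℕ → Set
Idx⁻ m = Fin (suc m)

top : (m : ℕ) → Idx m
top m = fromℕ (suc m)

eqI : (m : ℕ) → Idx m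
eqI m = zero

Hom : ℕ → ℕ → Set
Hom m n = Idx⁻ n → Idx m

ext : ∀ {n} {X : Set} → (Idx⁻ n → X) → X → Idx n → X
ext {zero}  f t zero          = f zero
ext {zero}  f t (suc zero)    = t
ext {suc n} f t zero          = f zero
ext {suc n} f t (suc i)       = ext {n} (λ k → f (suc k)) t i

_·_ : ∀ {m n} → Idx n → Hom m n → Idx m
_·_ {m} k F = ext F (top m) k

infixl 20 _·_

idH : (n : ℕ) → Hom n n
idH n k = inject₁ k

_∘H_ : ∀ {m n p} → Hom n p → Hom m n → Hom m p
(G ∘H F) k = G k · F

_≤H_ : ∀ {m n} → Hom m n → Hom m n → Set
F ≤H G = ∀ k → F k ≤ G k

record Reshuffle (m n : ℕ) : Set where
  field
    fun  : Hom m n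
    mono : ∀ {i j} → i ≤ j → fun i ≤ fun j
open Reshuffle public

_⋅_ : ∀ {m n} → Idx n → Reshuffle m n → Idx m
k ⋅ F = k · fun F

infixl 20 _⋅_

_⊣_ : ∀ {x y} → Reshuffle x y → Reshuffle y x → Set
_⊣_ {x} {y} L R = (idH x ≤H (fun R ∘H fun L)) × ((fun L ∘H fun R) ≤H idH y)

module Submission where

-- With it, the unit and
-- the counit of an adjunction L ⊣ R extend to all indices, which gives the
-- classical equivalence
--     L ⊣ R   ⇔   (i ≤ j·L  ⇔  i·R ≤ j  for all i, j),
-- the "Galois condition".  The existence criteria follow from it.
--   * Necessity: taking i = j = "=" forces =·R = =; taking i = ⊤ shows that
--     j·L = ⊤ forces j = ⊤.
--   * Sufficiency: the adjoint is built by finite search, j·L being the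
--     greatest i with i·R ≤ j, resp. i·R the least j with i ≤ j·L; the
--     hypothesis is exactly what makes the searched set non-empty (for L),
--     resp. what makes the Galois condition hold at i = ⊤ (for R).

open import Defs
open import Data.Nat using (ℕ; zero; suc; z≤n; s≤s)
open import Data.Nat.Properties using (<⇒≱)
open import Data.Fin using (Fin; zero; suc; inject₁; _≤_; _<_; _≤?_)
open import Data.Fin.Properties
  using (≤-trans; ≤-refl; ≤-reflexive; ≤-antisym; ≤fromℕ; toℕ-inject₁; toℕ-fromℕ; toℕ<n; ≤∧≢⇒<)
open import Data.Product using (_×_; ∃; _,_)
open import Data.Sum using (_⊎_; inj₁; inj₂)
open import Data.Empty using (⊥-elim)
open import Relation.Nullary using (¬_; Dec; yes; no)
open import Function.Bundles using (_⇔_; mk⇔; Equivalence)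
open import Relation.Binary.PropositionalEquality using (_≡_; refl; sym; subst)

open Equivalence using (to; from)

record Greatest {k : ℕ} (P : Fin k → Set) : Set where
  constructor greatest
  field
    point : Fin k
    holds : P point
    bound : ∀ i → P i → i ≤ point

record Least {k : ℕ} (P : Fin k → Set) : Set where
  constructor least
  field
    point : Fin k
    holds : P point
    bound : ∀ i → P i → point ≤ i

greatest? : ∀ {k} {P : Fin k → Set} → (∀ i → Dec (P i)) → (∀ i → ¬ P i) ⊎ Greatest P
greatest? {zero}  P? = inj₁ (λ ())
greatest? {suc k} P? with greatest? (λ i → P? (suc i)) | P? zero
... | inj₂ (greatest g Pg above) | _ =
  inj₂ (greatest (suc g) Pg λ { zero _ → z≤n ; (suc i) Pi → s≤s (above i Pi) })
... | inj₁ noSuc | yes P0 =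
  inj₂ (greatest zero P0 λ { zero _ → z≤n ; (suc i) Pi → ⊥-elim (noSuc i Pi) })
... | inj₁ noSuc | no ¬P0 = inj₁ λ { zero P0 → ¬P0 P0 ; (suc i) Pi → noSuc i Pi }

least? : ∀ {k} {P : Fin k → Set} → (∀ i → Dec (P i)) → (∀ i → ¬ P i) ⊎ Least P
least? {zero}  P? = inj₁ (λ ())
least? {suc k} P? with P? zero | least? (λ i → P? (suc i))
... | yes P0 | _ = inj₂ (least zero P0 λ _ _ → z≤n)
... | no ¬P0 | inj₂ (least g Pg below) =
  inj₂ (least (suc g) Pg λ { zero P0 → ⊥-elim (¬P0 P0) ; (suc i) Pi → s≤s (below i Pi) })
... | no ¬P0 | inj₁ noSuc = inj₁ λ { zero P0 → ¬P0 P0 ; (suc i) Pi → noSuc i Pi }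

greatestOf : ∀ {k} {P : Fin k → Set} → (∀ i → Dec (P i)) → ∀ w → P w → Greatest P
greatestOf P? w Pw with greatest? P?
... | inj₁ empty = ⊥-elim (empty w Pw)
... | inj₂ g     = g

leastOf : ∀ {k} {P : Fin k → Set} → (∀ i → Dec (P i)) → ∀ w → P w → Least P
leastOf P? w Pw with least? P?
... | inj₁ empty = ⊥-elim (empty w Pw)
... | inj₂ l     = l

greatest-mono : ∀ {k} {P Q : Fin k → Set} → (∀ i → P i → Q i) →
                (g : Greatest P) (h : Greatest Q) → Greatest.point g ≤ Greatest.point h
greatest-mono P⊆Q (greatest g Pg _) (greatest _ _ above) = above g (P⊆Q g Pg)

least-antitone : ∀ {k} {P Q : Fin k → Set} → (∀ i → Q i → P i) →
                 (l : Least P) (h : Least Q) → Least.point l ≤ Least.point h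
least-antitone Q⊆P (least _ _ below) (least h Qh _) = below h (Q⊆P h Qh)

data Finiteness (n : ℕ) : Idx n → Set where
  finite   : (k : Idx⁻ n) → Finiteness n (inject₁ k)
  infinite : Finiteness n (top n)

finiteness : ∀ {n} (i : Idx n) → Finiteness n i
finiteness {zero}  zero       = finite zero
finiteness {zero}  (suc zero) = infinite
finiteness {suc n} zero       = finite zero
finiteness {suc n} (suc i) with finiteness i
... | finite k = finite (suc k)
... | infinite = infinite

inject₁-≤ : ∀ {n} {a b : Idx⁻ n} → a ≤ b → inject₁ a ≤ inject₁ b
inject₁-≤ {a = a} {b} a≤b rewrite toℕ-inject₁ a | toℕ-inject₁ b = a≤b

inject₁-≤⁻¹ : ∀ {n} {a b : Idx⁻ n} → inject₁ a ≤ inject₁ b → a ≤ b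
inject₁-≤⁻¹ {a = a} {b} a≤b rewrite toℕ-inject₁ a | toℕ-inject₁ b = a≤b

≤-top : ∀ {n} (i : Idx n) → i ≤ top n
≤-top i = ≤fromℕ i

finite<top : ∀ {n} (k : Idx⁻ n) → inject₁ k < top n
finite<top {n} k rewrite toℕ-inject₁ k | toℕ-fromℕ (suc n) = toℕ<n k

top≰finite : ∀ {n} (k : Idx⁻ n) → ¬ (top n ≤ inject₁ k)
top≰finite k = <⇒≱ (finite<top k)

module _ {m n : ℕ} (F : Reshuffle m n) where

  ⋅-finite : (k : Idx⁻ n) → inject₁ k ⋅ F ≡ fun F k
  ⋅-finite = ext-finite (fun F)
    where
    ext-finite : ∀ {n} (f : Idx⁻ n → Idx m) (k : Idx⁻ n) → ext f (top m) (inject₁ k) ≡ f k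
    ext-finite {zero}  f zero    = refl
    ext-finite {suc n} f zero    = refl
    ext-finite {suc n} f (suc k) = ext-finite (λ k → f (suc k)) k

  ⋅-top : top n ⋅ F ≡ top m
  ⋅-top = ext-top (fun F)
    where
    ext-top : ∀ {n} (f : Idx⁻ n → Idx m) → ext f (top m) (top n) ≡ top m
    ext-top {zero}  f = refl
    ext-top {suc n} f = ext-top (λ k → f (suc k))

  ⋅-mono : ∀ {i j : Idx n} → i ≤ j → i ⋅ F ≤ j ⋅ F
  ⋅-mono {i} {j} i≤j with finiteness i | finiteness j
  ... | finite a | finite b rewrite ⋅-finite a | ⋅-finite b = mono F (inject₁-≤⁻¹ i≤j)
  ... | finite a | infinite rewrite ⋅-top = ≤-top _
  ... | infinite | finite b = ⊥-elim (top≰finite b i≤j)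
  ... | infinite | infinite = ≤-refl

  ≤-top⋅ : ∀ (i : Idx m) → i ≤ top n ⋅ F
  ≤-top⋅ i = subst (λ t → i ≤ t) (sym ⋅-top) (≤-top i)

Galois : ∀ {m n} → Reshuffle n m → Reshuffle m n → Set
Galois {m} {n} L R = ∀ (i : Idx n) (j : Idx m) → (i ≤ j ⋅ L) ⇔ (i ⋅ R ≤ j)

module _ {m n : ℕ} (L : Reshuffle n m) (R : Reshuffle m n) where

  unit : L ⊣ R → ∀ i → i ≤ i ⋅ R ⋅ L
  unit (η , _) i with finiteness i
  ... | finite k rewrite ⋅-finite R k = η k
  ... | infinite rewrite ⋅-top R | ⋅-top L = ≤-refl

  counit : L ⊣ R → ∀ j → j ⋅ L ⋅ R ≤ j
  counit (_ , ε) j with finiteness j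
  ... | finite k rewrite ⋅-finite L k = ε k
  ... | infinite rewrite ⋅-top L | ⋅-top R = ≤-refl

  adjunction⇒galois : L ⊣ R → Galois L R
  adjunction⇒galois adj i j = mk⇔
    (λ i≤jL → ≤-trans (⋅-mono R i≤jL) (counit adj j))
    (λ iR≤j → ≤-trans (unit adj i) (⋅-mono L iR≤j))

  -- Conversely, unit and counit are the instances j = i·R and i = j·L.
  galois⇒adjunction : Galois L R → L ⊣ R
  galois⇒adjunction galois =
      (λ k → from (galois (inject₁ k) (fun R k)) (≤-reflexive (⋅-finite R k)))
    , (λ k → to (galois (fun L k) (inject₁ k)) (≤-reflexive (sym (⋅-finite L k))))

  -- A right adjoint preserves "=": from = ≤ =·L we get =·R ≤ =.
  rightAdjoint-preserves-= : L ⊣ R → eqI n ⋅ R ≡ eqI m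
  rightAdjoint-preserves-= adj = ≤-antisym (to (adjunction⇒galois adj zero zero) z≤n) z≤n

  -- A left adjoint sends finite indices to finite indices: if j·L = ⊤ then
  -- ⊤ ≤ j·L, hence ⊤ = ⊤·R ≤ j.
  leftAdjoint-finite : L ⊣ R → ∀ j → j < top m → j ⋅ L < top n
  leftAdjoint-finite adj j j<⊤ = ≤∧≢⇒< (≤-top _) λ jL≡⊤ →
    <⇒≱ j<⊤ (subst (λ t → t ≤ j) (⋅-top R)
                    (to (adjunction⇒galois adj (top n) j) (≤-reflexive (sym jL≡⊤))))

-- Construction of the left adjoint of R when =·R = =:
-- j·L is the greatest i with i·R ≤ j; "=" belongs to that set.
module LeftAdjoint {m n : ℕ} (R : Reshuffle m n) (R= : eqI n ⋅ R ≡ eqI m) where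

  below : (j : Idx⁻ m) → Greatest (λ (i : Idx n) → i ⋅ R ≤ inject₁ j)
  below j = greatestOf (λ i → i ⋅ R ≤? inject₁ j) zero
                       (subst (λ e → e ≤ inject₁ j) (sym R=) z≤n)

  L : Reshuffle n m
  L = record
    { fun  = λ j → Greatest.point (below j)
    ; mono = λ j≤j′ → greatest-mono (λ i iR≤j → ≤-trans iR≤j (inject₁-≤ j≤j′))
                                    (below _) (below _)
    }

  galois : Galois L R
  galois i j with finiteness j
  ... | infinite = mk⇔ (λ _ → ≤-top _) (λ _ → ≤-top⋅ L i)
  ... | finite k rewrite ⋅-finite L k = mk⇔
    (λ i≤jL → ≤-trans (⋅-mono R i≤jL) (Greatest.holds (below k)))
    (Greatest.bound (below k) i)

-- Construction of the right adjoint of L when L keeps finite indices finite: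
-- i·R is the least j with i ≤ j·L; ⊤ belongs to that set.
module RightAdjoint {m n : ℕ} (L : Reshuffle n m)
                    (L<⊤ : ∀ (j : Idx m) → j < top m → j ⋅ L < top n) where

  above : (i : Idx⁻ n) → Least (λ (j : Idx m) → inject₁ i ≤ j ⋅ L)
  above i = leastOf (λ j → inject₁ i ≤? j ⋅ L) (top m) (≤-top⋅ L _)

  R : Reshuffle m n
  R = record
    { fun  = λ i → Least.point (above i)
    ; mono = λ i≤i′ → least-antitone (λ j i′≤jL → ≤-trans (inject₁-≤ i≤i′) i′≤jL)
                                     (above _) (above _)
    }

  galois : Galois L R
  galois i j with finiteness i
  ... | finite k rewrite ⋅-finite R k = mk⇔
    (Least.bound (above k) j)
    (λ iR≤j → ≤-trans (Least.holds (above k)) (⋅-mono L iR≤j))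
  ... | infinite rewrite ⋅-top R with finiteness j
  ...   | infinite = mk⇔ (λ _ → ≤-refl) (λ _ → ≤-top⋅ L (top n))
  ...   | finite b = mk⇔
    (λ ⊤≤bL → ⊥-elim (<⇒≱ (L<⊤ (inject₁ b) (finite<top b)) ⊤≤bL))
    (λ ⊤≤b → ⊥-elim (top≰finite b ⊤≤b))

mainTheorem13 : (m n : ℕ)
    → ((L : Reshuffle n m) (R : Reshuffle m n)
        → (L ⊣ R) ⇔ (∀ (i : Idx n) (j : Idx m) → (i ≤ j ⋅ L) ⇔ (i ⋅ R ≤ j)))
    × ((R : Reshuffle m n)
        → ((∃ λ (L : Reshuffle n m) → L ⊣ R) ⇔ (eqI n ⋅ R ≡ eqI m))
        × ((L : Reshuffle n m) → L ⊣ R → ∀ (j : Idx m)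
            → (j ⋅ L ⋅ R ≤ j) × (∀ (i : Idx n) → i ⋅ R ≤ j → i ≤ j ⋅ L)))
    × ((L : Reshuffle n m)
        → ((∃ λ (R : Reshuffle m n) → L ⊣ R) ⇔ (∀ (j : Idx m) → j < top m → j ⋅ L < top n))
        × ((R : Reshuffle m n) → L ⊣ R → ∀ (i : Idx n)
            → (i ≤ i ⋅ R ⋅ L) × (∀ (j : Idx m) → i ≤ j ⋅ L → i ⋅ R ≤ j)))
mainTheorem13 m n = adjunction⇔galois , leftAdjointCriterion , rightAdjointCriterion
  where
  adjunction⇔galois : (L : Reshuffle n m) (R : Reshuffle m n) → (L ⊣ R) ⇔ Galois L R
  adjunction⇔galois L R = mk⇔ (adjunction⇒galois L R) (galois⇒adjunction L R)

  leftAdjointCriterion : (R : Reshuffle m n)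
    → ((∃ λ (L : Reshuffle n m) → L ⊣ R) ⇔ (eqI n ⋅ R ≡ eqI m))
    × ((L : Reshuffle n m) → L ⊣ R → ∀ (j : Idx m)
        → (j ⋅ L ⋅ R ≤ j) × (∀ (i : Idx n) → i ⋅ R ≤ j → i ≤ j ⋅ L))
  leftAdjointCriterion R =
      mk⇔ (λ (L , adj) → rightAdjoint-preserves-= L R adj)
          (λ R= → let open LeftAdjoint R R= in L , galois⇒adjunction L R galois)
    , λ L adj j → counit L R adj j , λ i → from (adjunction⇒galois L R adj i j)

  rightAdjointCriterion : (L : Reshuffle n m)
    → ((∃ λ (R : Reshuffle m n) → L ⊣ R) ⇔ (∀ (j : Idx m) → j < top m → j ⋅ L < top n))
    × ((R : Reshuffle m n) → L ⊣ R → ∀ (i : Idx n)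
        → (i ≤ i ⋅ R ⋅ L) × (∀ (j : Idx m) → i ≤ j ⋅ L → i ⋅ R ≤ j))
  rightAdjointCriterion L =
      mk⇔ (λ (R , adj) → leftAdjoint-finite L R adj)
          (λ L<⊤ → let open RightAdjoint L L<⊤ in R , galois⇒adjunction L R galois)
    , λ R adj i → unit L R adj i , λ j → to (adjunction⇒galois L R adj i j)
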